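{- Let $P$ be a finite poset with a unique minimal element. Then every irreducible inclusion representation $\mathcal{S}$ of $P$ satisfies $|\bigcup\mathcal{S}|\le|P|-1$.
   Context: An inclusion representation of $P$ is a family $\mathcal{S}=(S_x:x\in P)$ of sets with $x\le y$ iff $S_x\subseteq S_y$; its ground set is $\bigcup\mathcal{S}$. $\mathcal{S}$ is a reduction of $\mathcal{S}'$ if $|\bigcup\mathcal{S}|\le|\bigcup\mathcal{S}'|$ and $|S_x|\le|S'_x|$ for all $x$; equivalent means mutual reductions; strict reduction means a non-equivalent reduction; $\mathcal{S}$ is irreducible if it has no strict reduction. -}

module Defs where

open import Data.Nat using (ℕ; _≤_)
open import Data.Fin using (Fin)
open import Data.Fin.Subset using (Subset; _⊆_; ⋃; ∣_∣)
open import Data.List using (map; allFin)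
open import Data.Product using (Σ; _×_)
open import Data.Empty using (⊥)
open import Relation.Nullary using (¬_)
open import Relation.Binary.PropositionalEquality using (_≡_)
open import Relation.Binary.Structures using (IsPartialOrder)
open import Function.Bundles using (_⇔_)

record FinPoset : Set₁ where
  field
    size      : ℕ
    _≼_       : Fin size → Fin size → Set
    isPartialOrder : IsPartialOrder _≡_ _≼_

open FinPoset public

Minimal : (P : FinPoset) → Fin (size P) → Set
Minimal P m = ∀ y → _≼_ P y m → y ≡ m

UniqueMinimal : FinPoset → Set
UniqueMinimal P = Σ (Fin (size P)) λ m → Minimal P m × (∀ m' → Minimal P m' → m' ≡ m)

Family : FinPoset → ℕ → Set
Family P k = Fin (size P) → Subset k

IsInclusionRep : (P : FinPoset) {k : ℕ} → Family P k → Set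
IsInclusionRep P S = ∀ x y → (_≼_ P x y ⇔ (S x ⊆ S y))

ground : (P : FinPoset) {k : ℕ} → Family P k → Subset k
ground P S = ⋃ (map S (allFin (size P)))

Reduction : (P : FinPoset) {k k' : ℕ} → Family P k → Family P k' → Set
Reduction P S S' = (∣ ground P S ∣ ≤ ∣ ground P S' ∣) × (∀ x → ∣ S x ∣ ≤ ∣ S' x ∣)

Equivalent : (P : FinPoset) {k k' : ℕ} → Family P k → Family P k' → Set
Equivalent P S S' = Reduction P S S' × Reduction P S' S

StrictReduction : (P : FinPoset) {k k' : ℕ} → Family P k → Family P k' → Set
StrictReduction P S S' = Reduction P S S' × ¬ Equivalent P S S'

Irreducible : (P : FinPoset) {k : ℕ} → Family P k → Set
Irreducible P {k} S =
  ∀ (k' : ℕ) (S' : Family P k') → IsInclusionRep P S' → ¬ StrictReduction P S' S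

{-# OPTIONS --safe #-}
-- Let m be the least element of P (a finite poset with a unique minimal element has one),
-- G the ground set, and for a set X of points let N(X) = {w ≠ m : S_w meets X}. Delete X
-- from every S_x and add a fresh point w to S_x for each w ∈ N(X) with w ≤ x. This is
-- again an inclusion representation: if the new S_x is contained in the new S_y, then
-- either S_x misses X and S_x ⊆ S_y already, or x = m, or x ∈ N(X) and the fresh point x
-- lies in the new S_y. Choose X maximising |X ∩ G| − |N(X)|. Comparing X with X ∖ S_x
-- shows that S_x gains at most the |S_x ∩ X| points it loses, and comparing X with G,
-- where m ∉ N(G), gives |N(X)| < |X ∩ G| once |G| ≥ |P|. The ground set then strictly
-- shrinks, which contradicts irreducibility.
module Submission where

open import Defs
open import Data.Nat using (ℕ; suc; _≤_; _<_; _∸_; _+_; z≤n; s≤s)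
open import Data.Nat.Induction using (<-wellFounded)
open import Data.Nat.Properties
  using (≤-trans; ≤-reflexive; _≤?_; ≰⇒>; ≤⇒≯; <⇒≤; +-comm; +-assoc; +-suc;
         +-mono-≤; +-monoˡ-≤; +-monoʳ-≤; +-monoʳ-<; +-cancelˡ-≤; +-cancelʳ-≤; m+[n∸m]≡n;
         pred[m∸n]≡m∸[1+n]; suc[m]≤n⇒m≤pred[n];
         +-commutativeSemigroup; module ≤-Reasoning)
open import Algebra.Properties.CommutativeSemigroup +-commutativeSemigroup using (x∙yz≈y∙xz)
open import Data.Fin using (Fin; _≟_)
open import Data.Fin.Properties using (any?)
open import Data.Fin.Subset
  using (Subset; _∈_; _⊆_; _∩_; ∁; ⋃; Nonempty; ∣_∣; inside; outside)
open import Data.Fin.Subset.Properties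
  using (_∈?_; _⊆?_; nonempty?; p⊆q⇒∣p∣≤∣q∣; p⊂q⇒∣p∣<∣q∣; drop-∷-⊆; out⊆; in⊆in;
         x∈p∩q⁺; x∈p∩q⁻; p∩q⊆p; x∈p∪q⁺; x∈p∪q⁻; x∉p⇒x∈∁p; x∈∁p⇒x∉p; p⊆q⇒∁p⊇∁q;
         ∣∁p∣≡n∸∣p∣; ∣p∣≤n; ∉⊥; x∈p⇒∣p-x∣<∣p∣; ∩-comm; ∩-idem)
open import Data.Vec using ([]; _∷_; _++_; tabulate; here)
open import Data.Vec.Properties using (lookup∘tabulate; lookup⇒[]=; []=⇒lookup)
open import Data.List using (List; []; _∷_; allFin)
open import Data.List.Relation.Unary.Any using (here; there)
open import Data.List.Membership.Propositional using () renaming (_∈_ to _∈ₗ_)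
open import Data.List.Membership.Propositional.Properties using (∈-allFin; ∈-map⁺; ∈-map⁻)
open import Data.Product using (Σ; ∃; _×_; _,_; proj₁; proj₂; map₁)
open import Data.Sum using (inj₁; inj₂; [_,_]′)
open import Data.Empty using (⊥-elim)
open import Function using (_∘_; id)
open import Function.Bundles using (Equivalence; mk⇔)
open import Level using (Level)
open import Relation.Nullary using (yes; no; does)
open import Relation.Nullary.Decidable
  using (_×-dec_; ¬?; dec-true; decidable-stable; map′)
open import Relation.Unary using (Pred; Decidable)
open import Relation.Binary.Definitions using () renaming (Decidable to Decidable₂)
open import Relation.Binary.PropositionalEquality using (_≡_; _≢_; refl; sym; trans; cong; subst)
open import Relation.Binary.Structures using (IsPartialOrder)
open import Induction.WellFounded using (Acc; acc)

private
  variable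
    ℓ : Level
    n k : ℕ

toSubset : {P : Pred (Fin n) ℓ} → Decidable P → Subset n
toSubset P? = tabulate (does ∘ P?)

module _ {P : Pred (Fin n) ℓ} (P? : Decidable P) where

  ∈-toSubset⁺ : ∀ {x} → P x → x ∈ toSubset P?
  ∈-toSubset⁺ {x} Px = lookup⇒[]= x _ (trans (lookup∘tabulate _ x) (dec-true (P? x) Px))

  ∈-toSubset⁻ : ∀ {x} → x ∈ toSubset P? → P x
  ∈-toSubset⁻ {x} x∈ with P? x | trans (sym (lookup∘tabulate _ x)) ([]=⇒lookup x∈)
  ... | yes Px | _ = Px

∣p∣≡∣p∩q∣+∣p∩∁q∣ : ∀ (p q : Subset n) → ∣ p ∣ ≡ ∣ p ∩ q ∣ + ∣ p ∩ ∁ q ∣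
∣p∣≡∣p∩q∣+∣p∩∁q∣ []            []            = refl
∣p∣≡∣p∩q∣+∣p∩∁q∣ (outside ∷ p) (_       ∷ q) = ∣p∣≡∣p∩q∣+∣p∩∁q∣ p q
∣p∣≡∣p∩q∣+∣p∩∁q∣ (inside  ∷ p) (inside  ∷ q) = cong suc (∣p∣≡∣p∩q∣+∣p∩∁q∣ p q)
∣p∣≡∣p∩q∣+∣p∩∁q∣ (inside  ∷ p) (outside ∷ q) =
  trans (cong suc (∣p∣≡∣p∩q∣+∣p∩∁q∣ p q)) (sym (+-suc ∣ p ∩ q ∣ ∣ p ∩ ∁ q ∣))

∣p∣+∣∁p∣≡n : ∀ (p : Subset n) → ∣ p ∣ + ∣ ∁ p ∣ ≡ n
∣p∣+∣∁p∣≡n p = trans (cong (∣ p ∣ +_) (∣∁p∣≡n∸∣p∣ p)) (m+[n∸m]≡n (∣p∣≤n p))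

x∈p⇒0<∣p∣ : ∀ {x} {p : Subset n} → x ∈ p → 0 < ∣ p ∣
x∈p⇒0<∣p∣ x∈p = ≤-trans (s≤s z≤n) (x∈p⇒∣p-x∣<∣p∣ x∈p)

∣p++q∣≡∣p∣+∣q∣ : ∀ (p : Subset n) (q : Subset k) → ∣ p ++ q ∣ ≡ ∣ p ∣ + ∣ q ∣
∣p++q∣≡∣p∣+∣q∣ []            q = refl
∣p++q∣≡∣p∣+∣q∣ (outside ∷ p) q = ∣p++q∣≡∣p∣+∣q∣ p q
∣p++q∣≡∣p∣+∣q∣ (inside  ∷ p) q = cong suc (∣p++q∣≡∣p∣+∣q∣ p q)

++-⊆⁺ : ∀ {p r : Subset n} {q s : Subset k} → p ⊆ r → q ⊆ s → p ++ q ⊆ r ++ s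
++-⊆⁺ {p = []}          {[]}          _   q⊆s = q⊆s
++-⊆⁺ {p = outside ∷ p} {_ ∷ r}       p⊆r q⊆s = out⊆ (++-⊆⁺ (drop-∷-⊆ p⊆r) q⊆s)
++-⊆⁺ {p = inside ∷ p}  {inside ∷ r}  p⊆r q⊆s = in⊆in (++-⊆⁺ (drop-∷-⊆ p⊆r) q⊆s)
++-⊆⁺ {p = inside ∷ p}  {outside ∷ r} p⊆r q⊆s with () ← p⊆r here

++-⊆⁻ : ∀ {p r : Subset n} {q s : Subset k} → p ++ q ⊆ r ++ s → p ⊆ r × q ⊆ s
++-⊆⁻ {p = []}          {[]}          h = (λ ()) , h
++-⊆⁻ {p = outside ∷ p} {_ ∷ r}       h = map₁ out⊆ (++-⊆⁻ (drop-∷-⊆ h))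
++-⊆⁻ {p = inside ∷ p}  {inside ∷ r}  h = map₁ in⊆in (++-⊆⁻ (drop-∷-⊆ h))
++-⊆⁻ {p = inside ∷ p}  {outside ∷ r} h with () ← h here

⋃-least : ∀ {ps : List (Subset n)} {q} → (∀ {p} → p ∈ₗ ps → p ⊆ q) → ⋃ ps ⊆ q
⋃-least {ps = []}     _   x∈ = ⊥-elim (∉⊥ x∈)
⋃-least {ps = p ∷ ps} ps⊆ x∈ =
  [ ps⊆ (here refl) , ⋃-least (ps⊆ ∘ there) ]′ (x∈p∪q⁻ p (⋃ ps) x∈)

p⊆⋃ : ∀ {ps : List (Subset n)} {p} → p ∈ₗ ps → p ⊆ ⋃ ps
p⊆⋃ (here refl) x∈ = x∈p∪q⁺ (inj₁ x∈)
p⊆⋃ (there p∈)  x∈ = x∈p∪q⁺ (inj₂ (p⊆⋃ p∈ x∈))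

argmax : (f : Subset k → ℕ) → Σ (Subset k) λ X → ∀ Y → f Y ≤ f X
argmax {k = 0}     f = [] , λ { [] → ≤-reflexive refl }
argmax {k = suc k} f with argmax (f ∘ (inside ∷_)) | argmax (f ∘ (outside ∷_))
... | X₁ , max₁ | X₀ , max₀ with f (inside ∷ X₁) ≤? f (outside ∷ X₀)
... | yes ₁≤₀ = outside ∷ X₀ , λ where
  (inside  ∷ Y) → ≤-trans (max₁ Y) ₁≤₀
  (outside ∷ Y) → max₀ Y
... | no ₁≰₀ = inside ∷ X₁ , λ where
  (inside  ∷ Y) → max₁ Y
  (outside ∷ Y) → ≤-trans (max₀ Y) (<⇒≤ (≰⇒> ₁≰₀))

module _ (P : FinPoset) (_⊑?_ : Decidable₂ (_≼_ P)) where
  private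
    open FinPoset P using () renaming (_≼_ to _⊑_)
    open IsPartialOrder (isPartialOrder P)
      using (antisym) renaming (refl to ⊑-refl; trans to ⊑-trans)

    ↓ : Fin (size P) → Subset (size P)
    ↓ y = toSubset (_⊑? y)

    ∣↓∣-strictMono : ∀ {w y} → w ⊑ y → w ≢ y → ∣ ↓ w ∣ < ∣ ↓ y ∣
    ∣↓∣-strictMono {w} {y} w⊑y w≢y = p⊂q⇒∣p∣<∣q∣
      ( (λ z∈ → ∈-toSubset⁺ (_⊑? y) (⊑-trans (∈-toSubset⁻ (_⊑? w) z∈) w⊑y))
      , y , ∈-toSubset⁺ (_⊑? y) ⊑-refl , λ y∈ → w≢y (antisym w⊑y (∈-toSubset⁻ (_⊑? w) y∈)) )

    minimal-below-acc : ∀ y → Acc _<_ ∣ ↓ y ∣ → ∃ λ z → Minimal P z × z ⊑ y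
    minimal-below-acc y (acc rec) with any? (λ w → (w ⊑? y) ×-dec ¬? (w ≟ y))
    ... | yes (w , w⊑y , w≢y) =
      let z , z-min , z⊑w = minimal-below-acc w (rec (∣↓∣-strictMono w⊑y w≢y))
      in z , z-min , ⊑-trans z⊑w w⊑y
    ... | no nothing-below =
      y , (λ w w⊑y → decidable-stable (w ≟ y) λ w≢y → nothing-below (w , w⊑y , w≢y)) , ⊑-refl

  minimal-below : ∀ y → ∃ λ z → Minimal P z × _≼_ P z y
  minimal-below y = minimal-below-acc y (<-wellFounded _)

  uniqueMinimal⇒least : ((m , _) : UniqueMinimal P) → ∀ y → _≼_ P m y
  uniqueMinimal⇒least (m , _ , unique) y =
    let z , z-min , z≼y = minimal-below y in subst (λ z → _≼_ P z y) (unique z z-min) z≼y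

module _ (P : FinPoset) {k} (S : Family P k) where

  ⊆-ground : ∀ x → S x ⊆ ground P S
  ⊆-ground x = p⊆⋃ (∈-map⁺ S (∈-allFin x))

  ground-least : ∀ {B} → (∀ x → S x ⊆ B) → ground P S ⊆ B
  ground-least {B} S⊆B = ⋃-least λ p∈ →
    let x , _ , p≡Sx = ∈-map⁻ S {xs = allFin (size P)} p∈ in subst (_⊆ B) (sym p≡Sx) (S⊆B x)

  inclusionRep⇒decidable : IsInclusionRep P S → Decidable₂ (_≼_ P)
  inclusionRep⇒decidable rep x y =
    map′ (Equivalence.from (rep x y)) (Equivalence.to (rep x y)) (S x ⊆? S y)

strictReduction-byGround : ∀ (P : FinPoset) {k k′} (S : Family P k) (S′ : Family P k′) →
  Reduction P S′ S → ∣ ground P S′ ∣ < ∣ ground P S ∣ → StrictReduction P S′ S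
strictReduction-byGround P S S′ red smaller = red , λ (_ , ∣G∣≤∣G′∣ , _) → ≤⇒≯ ∣G∣≤∣G′∣ smaller

module Reduce (P : FinPoset) {k} (S : Family P k) (S-rep : IsInclusionRep P S)
              (m : Fin (size P)) (m-least : ∀ y → _≼_ P m y) where

  private
    G : Subset k
    G = ground P S

  Touches : Subset k → Pred (Fin (size P)) _
  Touches X w = w ≢ m × Nonempty (S w ∩ X)

  touches? : ∀ X → Decidable (Touches X)
  touches? X w = ¬? (w ≟ m) ×-dec nonempty? (S w ∩ X)

  touching : Subset k → Subset (size P)
  touching X = toSubset (touches? X)

  ∈-touching⁺ : ∀ {X w} → Touches X w → w ∈ touching X
  ∈-touching⁺ {X} = ∈-toSubset⁺ (touches? X)

  ∈-touching⁻ : ∀ {X w} → w ∈ touching X → Touches X w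
  ∈-touching⁻ {X} = ∈-toSubset⁻ (touches? X)

  Below : Subset k → Fin (size P) → Pred (Fin (size P)) _
  Below X x w = w ∈ touching X × S w ⊆ S x

  below? : ∀ X x → Decidable (Below X x)
  below? X x w = (w ∈? touching X) ×-dec (S w ⊆? S x)

  below : Subset k → Fin (size P) → Subset (size P)
  below X x = toSubset (below? X x)

  ∈-below⁺ : ∀ {X x w} → Below X x w → w ∈ below X x
  ∈-below⁺ {X} {x} = ∈-toSubset⁺ (below? X x)

  ∈-below⁻ : ∀ {X x w} → w ∈ below X x → Below X x w
  ∈-below⁻ {X} {x} = ∈-toSubset⁻ (below? X x)

  reduced : Subset k → Family P (k + size P)
  reduced X x = (S x ∩ ∁ X) ++ below X x

  reduced-isInclusionRep : ∀ X → IsInclusionRep P (reduced X)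
  reduced-isInclusionRep X x y = mk⇔ preserves reflects
    where
    S-mono : _≼_ P x y → S x ⊆ S y
    S-mono = Equivalence.to (S-rep x y)

    preserves : _≼_ P x y → reduced X x ⊆ reduced X y
    preserves x≼y = ++-⊆⁺
      (λ a∈ → let a∈Sx , a∉X = x∈p∩q⁻ (S x) (∁ X) a∈ in x∈p∩q⁺ (S-mono x≼y a∈Sx , a∉X))
      (λ w∈ → let w-touches , Sw⊆Sx = ∈-below⁻ w∈ in ∈-below⁺ (w-touches , S-mono x≼y ∘ Sw⊆Sx))

    reflects : reduced X x ⊆ reduced X y → _≼_ P x y
    reflects h with ++-⊆⁻ h | nonempty? (S x ∩ X) | x ≟ m
    ... | outer , _ | no Sx∩X-empty | _ = Equivalence.from (S-rep x y) λ a∈Sx →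
      let a∉X = λ a∈X → Sx∩X-empty (_ , x∈p∩q⁺ (a∈Sx , a∈X))
      in proj₁ (x∈p∩q⁻ (S y) (∁ X) (outer (x∈p∩q⁺ (a∈Sx , x∉p⇒x∈∁p a∉X))))
    ... | _ | yes _ | yes refl = m-least y
    ... | _ , inner | yes Sx∩X-nonempty | no x≢m = Equivalence.from (S-rep x y)
      (proj₂ (∈-below⁻ (inner (∈-below⁺ (∈-touching⁺ (x≢m , Sx∩X-nonempty) , id)))))

  ground-reduced⊆ : ∀ X → ground P (reduced X) ⊆ (G ∩ ∁ X) ++ touching X
  ground-reduced⊆ X = ground-least P (reduced X) λ x → ++-⊆⁺
    (λ a∈ → let a∈Sx , a∉X = x∈p∩q⁻ (S x) (∁ X) a∈ in x∈p∩q⁺ (⊆-ground P S x a∈Sx , a∉X))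
    (proj₁ ∘ ∈-below⁻)

  touching-mono : ∀ {X Y} → X ⊆ Y → touching X ⊆ touching Y
  touching-mono X⊆Y w∈ =
    let w≢m , a , a∈ = ∈-touching⁻ w∈ ; a∈Sw , a∈X = x∈p∩q⁻ (S _) _ a∈
    in ∈-touching⁺ (w≢m , a , x∈p∩q⁺ (a∈Sw , X⊆Y a∈X))

  below⊆∁touching : ∀ X x → below X x ⊆ ∁ (touching (X ∩ ∁ (S x)))
  below⊆∁touching X x w∈ = x∉p⇒x∈∁p λ w∈′ →
    let _ , Sw⊆Sx = ∈-below⁻ w∈ ; _ , a , a∈ = ∈-touching⁻ w∈′
        a∈Sw , a∈X∖Sx = x∈p∩q⁻ (S _) _ a∈
    in x∈∁p⇒x∉p (proj₂ (x∈p∩q⁻ X (∁ (S x)) a∈X∖Sx)) (Sw⊆Sx a∈Sw)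

  m∉touching : ∀ X → m ∈ ∁ (touching X)
  m∉touching X = x∉p⇒x∈∁p λ m∈ → proj₁ (∈-touching⁻ m∈) refl

  -- |X ∩ G| − |touching X| shifted by size P, so that no truncated subtraction occurs.
  weight : Subset k → ℕ
  weight X = ∣ X ∩ G ∣ + ∣ ∁ (touching X) ∣

  ∣G∣<weight-G : ∣ G ∣ < weight G
  ∣G∣<weight-G = begin
    suc ∣ G ∣                ≡⟨ +-comm 1 (∣ G ∣) ⟩
    ∣ G ∣ + 1                ≡⟨ cong (λ Z → ∣ Z ∣ + 1) (∩-idem G) ⟨
    ∣ G ∩ G ∣ + 1            ≤⟨ +-monoʳ-≤ ∣ G ∩ G ∣ (x∈p⇒0<∣p∣ (m∉touching G)) ⟩
    weight G                 ∎
    where open ≤-Reasoning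

  ∣below∣+∣∁touching∣≤∣∁touching∣ : ∀ X x →
    ∣ below X x ∣ + ∣ ∁ (touching X) ∣ ≤ ∣ ∁ (touching (X ∩ ∁ (S x))) ∣
  ∣below∣+∣∁touching∣≤∣∁touching∣ X x = begin
    ∣ below X x ∣ + ∣ ∁ T ∣              ≤⟨ +-mono-≤
      (p⊆q⇒∣p∣≤∣q∣ λ w∈ → x∈p∩q⁺ (below⊆∁touching X x w∈ , proj₁ (∈-below⁻ w∈)))
      (p⊆q⇒∣p∣≤∣q∣ λ w∈ → x∈p∩q⁺ (p⊆q⇒∁p⊇∁q (touching-mono (p∩q⊆p X _)) w∈ , w∈)) ⟩
    ∣ ∁ T′ ∩ T ∣ + ∣ ∁ T′ ∩ ∁ T ∣        ≡⟨ ∣p∣≡∣p∩q∣+∣p∩∁q∣ (∁ T′) T ⟨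
    ∣ ∁ T′ ∣                             ∎
    where
    open ≤-Reasoning
    T T′ : Subset (size P)
    T  = touching X
    T′ = touching (X ∩ ∁ (S x))

  ∣X∩G∣≤∣S∩X∣+∣X∖S∩G∣ : ∀ X x → ∣ X ∩ G ∣ ≤ ∣ S x ∩ X ∣ + ∣ (X ∩ ∁ (S x)) ∩ G ∣
  ∣X∩G∣≤∣S∩X∣+∣X∖S∩G∣ X x = begin
    ∣ X ∩ G ∣                                      ≡⟨ ∣p∣≡∣p∩q∣+∣p∩∁q∣ (X ∩ G) (S x) ⟩
    ∣ (X ∩ G) ∩ S x ∣ + ∣ (X ∩ G) ∩ ∁ (S x) ∣      ≤⟨ +-mono-≤
      (p⊆q⇒∣p∣≤∣q∣ λ a∈ →
        let a∈X∩G , a∈Sx = x∈p∩q⁻ (X ∩ G) (S x) a∈ in x∈p∩q⁺ (a∈Sx , p∩q⊆p X G a∈X∩G))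
      (p⊆q⇒∣p∣≤∣q∣ λ a∈ →
        let a∈X∩G , a∉Sx = x∈p∩q⁻ (X ∩ G) (∁ (S x)) a∈ ; a∈X , a∈G = x∈p∩q⁻ X G a∈X∩G
        in x∈p∩q⁺ (x∈p∩q⁺ (a∈X , a∉Sx) , a∈G)) ⟩
    ∣ S x ∩ X ∣ + ∣ (X ∩ ∁ (S x)) ∩ G ∣            ∎
    where open ≤-Reasoning

  module Optimal (X : Subset k) (X-max : ∀ Y → weight Y ≤ weight X) where

    ∣below∣≤∣S∩X∣ : ∀ x → ∣ below X x ∣ ≤ ∣ S x ∩ X ∣
    ∣below∣≤∣S∩X∣ x = +-cancelʳ-≤ c _ _ (+-cancelˡ-≤ a _ _ (begin
      a + (∣ below X x ∣ + c)    ≤⟨ +-monoʳ-≤ a (∣below∣+∣∁touching∣≤∣∁touching∣ X x) ⟩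
      a + ∣ ∁ (touching Y) ∣     ≤⟨ X-max Y ⟩
      ∣ X ∩ G ∣ + c              ≤⟨ +-monoˡ-≤ c (∣X∩G∣≤∣S∩X∣+∣X∖S∩G∣ X x) ⟩
      ∣ S x ∩ X ∣ + a + c        ≡⟨ +-assoc (∣ S x ∩ X ∣) a c ⟩
      ∣ S x ∩ X ∣ + (a + c)      ≡⟨ x∙yz≈y∙xz (∣ S x ∩ X ∣) a c ⟩
      a + (∣ S x ∩ X ∣ + c)      ∎))
      where
      open ≤-Reasoning
      Y : Subset k
      Y = X ∩ ∁ (S x)
      a c : ℕ
      a = ∣ Y ∩ G ∣
      c = ∣ ∁ (touching X) ∣

    ∣reduced∣≤∣S∣ : ∀ x → ∣ reduced X x ∣ ≤ ∣ S x ∣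
    ∣reduced∣≤∣S∣ x = begin
      ∣ (S x ∩ ∁ X) ++ below X x ∣         ≡⟨ ∣p++q∣≡∣p∣+∣q∣ (S x ∩ ∁ X) (below X x) ⟩
      ∣ S x ∩ ∁ X ∣ + ∣ below X x ∣        ≤⟨ +-monoʳ-≤ ∣ S x ∩ ∁ X ∣ (∣below∣≤∣S∩X∣ x) ⟩
      ∣ S x ∩ ∁ X ∣ + ∣ S x ∩ X ∣          ≡⟨ +-comm (∣ S x ∩ ∁ X ∣) (∣ S x ∩ X ∣) ⟩
      ∣ S x ∩ X ∣ + ∣ S x ∩ ∁ X ∣          ≡⟨ ∣p∣≡∣p∩q∣+∣p∩∁q∣ (S x) X ⟨
      ∣ S x ∣                              ∎
      where open ≤-Reasoning

    ∣touching∣<∣X∩G∣ : size P ≤ ∣ G ∣ → ∣ touching X ∣ < ∣ X ∩ G ∣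
    ∣touching∣<∣X∩G∣ n≤∣G∣ = +-cancelʳ-≤ _ _ _ (begin
      suc ∣ T ∣ + ∣ G ∣                ≡⟨ +-suc (∣ T ∣) (∣ G ∣) ⟨
      ∣ T ∣ + suc ∣ G ∣                ≤⟨ +-monoʳ-≤ ∣ T ∣ (≤-trans ∣G∣<weight-G (X-max G)) ⟩
      ∣ T ∣ + (∣ X ∩ G ∣ + ∣ ∁ T ∣)    ≡⟨ x∙yz≈y∙xz (∣ T ∣) (∣ X ∩ G ∣) (∣ ∁ T ∣) ⟩
      ∣ X ∩ G ∣ + (∣ T ∣ + ∣ ∁ T ∣)    ≡⟨ cong (∣ X ∩ G ∣ +_) (∣p∣+∣∁p∣≡n T) ⟩
      ∣ X ∩ G ∣ + size P                ≤⟨ +-monoʳ-≤ ∣ X ∩ G ∣ n≤∣G∣ ⟩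
      ∣ X ∩ G ∣ + ∣ G ∣                ∎)
      where
      open ≤-Reasoning
      T : Subset (size P)
      T = touching X

    ∣ground-reduced∣<∣G∣ : size P ≤ ∣ G ∣ → ∣ ground P (reduced X) ∣ < ∣ G ∣
    ∣ground-reduced∣<∣G∣ n≤∣G∣ = begin-strict
      ∣ ground P (reduced X) ∣             ≤⟨ p⊆q⇒∣p∣≤∣q∣ (ground-reduced⊆ X) ⟩
      ∣ (G ∩ ∁ X) ++ touching X ∣          ≡⟨ ∣p++q∣≡∣p∣+∣q∣ (G ∩ ∁ X) (touching X) ⟩
      ∣ G ∩ ∁ X ∣ + ∣ touching X ∣         <⟨ +-monoʳ-< ∣ G ∩ ∁ X ∣ (∣touching∣<∣X∩G∣ n≤∣G∣) ⟩
      ∣ G ∩ ∁ X ∣ + ∣ X ∩ G ∣              ≡⟨ cong (λ Z → ∣ G ∩ ∁ X ∣ + ∣ Z ∣) (∩-comm X G) ⟩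
      ∣ G ∩ ∁ X ∣ + ∣ G ∩ X ∣              ≡⟨ +-comm (∣ G ∩ ∁ X ∣) (∣ G ∩ X ∣) ⟩
      ∣ G ∩ X ∣ + ∣ G ∩ ∁ X ∣              ≡⟨ ∣p∣≡∣p∩q∣+∣p∩∁q∣ G X ⟨
      ∣ G ∣                                ∎
      where open ≤-Reasoning

  irreducible⇒∣ground∣<size : Irreducible P S → ∣ G ∣ < size P
  irreducible⇒∣ground∣<size S-irr = ≰⇒> λ n≤∣G∣ →
    let shrinks = ∣ground-reduced∣<∣G∣ n≤∣G∣
    in S-irr _ (reduced X) (reduced-isInclusionRep X)
         (strictReduction-byGround P S (reduced X) (<⇒≤ shrinks , ∣reduced∣≤∣S∣) shrinks)
    where
    X : Subset k
    X = proj₁ (argmax weight)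
    open Optimal X (proj₂ (argmax weight))

corollary2p2 : (P : FinPoset) → UniqueMinimal P →
    (k : ℕ) (S : Family P k) → IsInclusionRep P S → Irreducible P S →
      ∣ ground P S ∣ ≤ size P ∸ 1
corollary2p2 P um k S S-rep S-irr =
  subst (∣ ground P S ∣ ≤_) (pred[m∸n]≡m∸[1+n] (size P) 0) (suc[m]≤n⇒m≤pred[n] ∣G∣<n)
  where
  m-least : ∀ y → _≼_ P (proj₁ um) y
  m-least = uniqueMinimal⇒least P (inclusionRep⇒decidable P S S-rep) um
  ∣G∣<n : ∣ ground P S ∣ < size P
  ∣G∣<n = Reduce.irreducible⇒∣ground∣<size P S S-rep (proj₁ um) m-least S-irr
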